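{- Let $n\ge 3$ be an integer and let $\mathbf{p},\mathbf{q}$ be join-irreducible elements of $\mathrm{Bip}(n)$. Then $\mathrm{con}(\mathbf{p})\subseteq\mathrm{con}(\mathbf{q})$ if and only if either $\mathbf{q}$ is bipartite, or $\mathbf{p}$ is a clepsydra and $\mathbf{p}=\mathbf{q}$.
   Context: $[n]=\{1,\dots,n\}$. $\mathrm{Bip}(n)$ is the set of bipartitions of $[n]$, i.e. transitive relations $\mathbf{x}\subseteq[n]\times[n]$ whose complement in $[n]\times[n]$ is also transitive, ordered by inclusion; it is a finite lattice (join = transitive closure of the union). Its join-irreducible elements are exactly the sets $([n]\setminus U)\times U$ for $\varnothing\neq U\subsetneq[n]$ (called bipartite) and the sets $(\{a\}\cup([n]\setminus U))\times(\{a\}\cup U)$ for $a\in[n]$, $U\subseteq[n]$ (called clepsydras). For a join-irreducible $\mathbf{p}$ with unique lower cover $\mathbf{p}_*$, $\mathrm{con}(\mathbf{p})$ is the least lattice congruence of $\mathrm{Bip}(n)$ identifying $\mathbf{p}_*$ and $\mathbf{p}$. -}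

module Defs where

open import Data.Nat using (ℕ)
open import Data.Fin using (Fin; _≟_)
open import Data.Bool using (Bool; true; false; not; _∧_; _∨_)
open import Data.Product using (Σ; ∃; _×_; _,_)
open import Data.Sum using (_⊎_)
open import Data.Empty using (⊥)
open import Relation.Nullary using (¬_; does)
open import Relation.Binary.PropositionalEquality using (_≡_)
open import Level using (Level; suc; zero)

BRel : ℕ → Set
BRel n = Fin n → Fin n → Bool

Transitive : {n : ℕ} → BRel n → Set
Transitive x = ∀ i j k → x i j ≡ true → x j k ≡ true → x i k ≡ true

CoTransitive : {n : ℕ} → BRel n → Set
CoTransitive x = ∀ i j k → x i j ≡ false → x j k ≡ false → x i k ≡ false

record Bip (n : ℕ) : Set where
  constructor mkBip
  field
    rel   : BRel n
    trans : Transitive rel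
    cotrans : CoTransitive rel
open Bip public

_⊆_ : {n : ℕ} → Bip n → Bip n → Set
x ⊆ y = ∀ i j → rel x i j ≡ true → rel y i j ≡ true

_≈_ : {n : ℕ} → Bip n → Bip n → Set
x ≈ y = (x ⊆ y) × (y ⊆ x)

IsJoin : {n : ℕ} → Bip n → Bip n → Bip n → Set
IsJoin x y z = (x ⊆ z) × (y ⊆ z) × (∀ w → x ⊆ w → y ⊆ w → z ⊆ w)

IsMeet : {n : ℕ} → Bip n → Bip n → Bip n → Set
IsMeet x y z = (z ⊆ x) × (z ⊆ y) × (∀ w → w ⊆ x → w ⊆ y → w ⊆ z)

record IsCongruence {n : ℕ} (θ : Bip n → Bip n → Set) : Set where
  field
    refl≈ : ∀ x y → x ≈ y → θ x y
    sym   : ∀ x y → θ x y → θ y x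
    trans : ∀ x y z → θ x y → θ y z → θ x z
    join-compat : ∀ x x' y y' z z' → θ x x' → θ y y' →
                  IsJoin x y z → IsJoin x' y' z' → θ z z'
    meet-compat : ∀ x x' y y' z z' → θ x x' → θ y y' →
                  IsMeet x y z → IsMeet x' y' z' → θ z z'

_⋖_ : {n : ℕ} → Bip n → Bip n → Set
c ⋖ p = (c ⊆ p) × ¬ (p ⊆ c) × (∀ z → c ⊆ z → z ⊆ p → (z ≈ c) ⊎ (z ≈ p))

IsBottom : {n : ℕ} → Bip n → Set
IsBottom {n} p = ∀ (x : Bip n) → p ⊆ x

JoinIrreducible : {n : ℕ} → Bip n → Set
JoinIrreducible {n} p =
  ¬ IsBottom p × (∀ (x y : Bip n) → IsJoin x y p → (p ≈ x) ⊎ (p ≈ y))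

-- con(p): least congruence identifying p with its (unique) lower cover p_*,
-- i.e. the intersection of all congruences θ with θ p_* p.
con : {n : ℕ} → Bip n → Bip n → Bip n → Set₁
con {n} p x y = ∀ (θ : Bip n → Bip n → Set) → IsCongruence θ →
                (∀ c → c ⋖ p → θ c p) → θ x y

_⊑_ : {n : ℕ} → Bip n → Bip n → Set₁
_⊑_ {n} p q = ∀ (x y : Bip n) → con p x y → con q x y

Bipartite : {n : ℕ} → Bip n → Set
Bipartite {n} q = Σ (Fin n → Bool) λ U →
  (∃ λ u → U u ≡ true) × (∃ λ v → U v ≡ false) ×
  (∀ i j → rel q i j ≡ (not (U i) ∧ U j))

Clepsydra : {n : ℕ} → Bip n → Set
Clepsydra {n} p = Σ (Fin n) λ a → Σ (Fin n → Bool) λ U →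
  (∀ i j → rel p i j ≡ ((does (i ≟ a) ∨ not (U i)) ∧ (does (j ≟ a) ∨ U j)))

module Submission where

-- A join-irreducible q either has no loop (i , i), and is then
-- the bipartite atom A(U) = ([n] ∖ U) × U, or has a loop at some a, and is then the
-- clepsydra with apex a and U = q(a , ·).  Both facts come from writing q as the
-- join of two restrictions of q and using join-irreducibility.
--
-- Bipartite q.  ⊥ is the lower cover of A(U), so any congruence of con(q) relates
-- ⊥ and A(U).  Joining with A(∁ U) and meeting with a second atom (a third point
-- is needed to choose it) propagates this to ⊥ and ⊤, so con(q) is total.
--
-- The "apex congruence" θ relates two bipartitions when they agree
-- away from (a , a) and, if they differ at (a , a), both have the row and column of
-- a prescribed by U.  θ is a lattice congruence relating every lower cover of the
-- clepsydra q to q, so con(q) ⊆ θ.  If con(p) ⊆ con(q), θ relates p to a lower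
-- cover, which forces p to be the same clepsydra.

open import Defs
open import Data.Nat using (ℕ; _≤_; s≤s; zero; suc)
open import Data.Bool using (Bool; true; false; not; _∧_; _∨_)
open import Data.Bool.Properties
  using (∧-conicalˡ; ∧-conicalʳ; ∨-conicalˡ; ∨-conicalʳ; ∧-zeroʳ; ∧-identityʳ; ∨-inverseˡ;
         ¬-not)
  renaming (_≟_ to _≟ᵇ_)
open import Data.Fin using (Fin; _≟_) renaming (zero to fz; suc to fs)
open import Data.Fin.Properties using (any?)
open import Data.Product using (_×_; _,_; proj₁; proj₂; Σ-syntax; ∃-syntax)
open import Data.Sum using (_⊎_; inj₁; inj₂; [_,_]) renaming (map to ⊎-map)
open import Data.Empty using (⊥; ⊥-elim)
open import Function.Bundles using (_⇔_; mk⇔)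
open import Relation.Nullary using (¬_; does; yes; no; Dec)
open import Relation.Nullary.Decidable using (dec-true; dec-false)
open import Relation.Binary.PropositionalEquality
  using (_≡_; _≢_; refl; cong; cong₂; subst) renaming (sym to ≡-sym; trans to ≡-trans)

clash : {b : Bool} → b ≡ true → b ≡ false → ⊥
clash refl ()

≢true⇒false : {b : Bool} → ¬ (b ≡ true) → b ≡ false
≢true⇒false = ¬-not

≢false⇒true : {b : Bool} → ¬ (b ≡ false) → b ≡ true
≢false⇒true = ¬-not

bool-split : (b : Bool) → b ≡ true ⊎ b ≡ false
bool-split true  = inj₁ refl
bool-split false = inj₂ refl

≡-from-⇔ : {b c : Bool} → (b ≡ true → c ≡ true) → (c ≡ true → b ≡ true) → b ≡ c
≡-from-⇔ {true}          f g = ≡-sym (f refl)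
≡-from-⇔ {false} {true}  f g = g refl
≡-from-⇔ {false} {false} f g = refl

∧-intro : {b c : Bool} → b ≡ true → c ≡ true → b ∧ c ≡ true
∧-intro refl refl = refl

∧-false : {b c : Bool} → b ∧ c ≡ false → b ≡ false ⊎ c ≡ false
∧-false {true}  h = inj₂ h
∧-false {false} h = inj₁ refl

∧-falseʳ : {b c : Bool} → b ≡ true → b ∧ c ≡ false → c ≡ false
∧-falseʳ refl h = h

∧-falseˡ : {b c : Bool} → c ≡ true → b ∧ c ≡ false → b ≡ false
∧-falseˡ {true}  refl h = h
∧-falseˡ {false} _    _ = refl

∨-true : {b c : Bool} → b ∨ c ≡ true → b ≡ true ⊎ c ≡ true
∨-true {true}  h = inj₁ refl
∨-true {false} h = inj₂ h

∨-introˡ : {b c : Bool} → b ≡ true → b ∨ c ≡ true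
∨-introˡ refl = refl

∨-introʳ : {b c : Bool} → c ≡ true → b ∨ c ≡ true
∨-introʳ {true}  _ = refl
∨-introʳ {false} h = h

∨-false : {b c : Bool} → b ≡ false → c ≡ false → b ∨ c ≡ false
∨-false refl refl = refl

not-true : {b : Bool} → not b ≡ true → b ≡ false
not-true {false} _ = refl

not-false : {b : Bool} → not b ≡ false → b ≡ true
not-false {true} _ = refl

not-intro : {b : Bool} → b ≡ false → not b ≡ true
not-intro refl = refl

does-witness : {P : Set} (d : Dec P) → does d ≡ true → P
does-witness (yes p) _ = p

-- Any two points of [n] leave out a third; this holds exactly when n ≥ 3.
ThreePoints : ℕ → Set
ThreePoints n = ∀ (u v : Fin n) → ∃[ w ] (w ≢ u × w ≢ v)

three-points : {n : ℕ} → 3 ≤ n → ThreePoints n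
three-points {suc zero}          (s≤s ())
three-points {suc (suc zero)}    (s≤s (s≤s ()))
three-points {suc (suc (suc m))} _ = third
  where
    third : ThreePoints (suc (suc (suc m)))
    third fz          fz          = fs fz , (λ ()) , (λ ())
    third fz          (fs fz)     = fs (fs fz) , (λ ()) , (λ ())
    third fz          (fs (fs _)) = fs fz , (λ ()) , (λ ())
    third (fs fz)     fz          = fs (fs fz) , (λ ()) , (λ ())
    third (fs (fs _)) fz          = fs fz , (λ ()) , (λ ())
    third (fs _)      (fs _)      = fz , (λ ()) , (λ ())

module _ {n : ℕ} where

  -- Order-theoretic basics on Bip n.  (Elements of Bip n cannot be inferred from
  -- their entries, so they are passed explicitly throughout.)

  ⊆-refl : (x : Bip n) → x ⊆ x
  ⊆-refl x i j h = h

  ⊆-trans : {x y z : Bip n} → x ⊆ y → y ⊆ z → x ⊆ z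
  ⊆-trans x⊆y y⊆z i j h = y⊆z i j (x⊆y i j h)

  ≈-refl : (x : Bip n) → x ≈ x
  ≈-refl x = ⊆-refl x , ⊆-refl x

  ≈-sym : {x y : Bip n} → x ≈ y → y ≈ x
  ≈-sym (x⊆y , y⊆x) = y⊆x , x⊆y

  ≈-trans : {x y z : Bip n} → x ≈ y → y ≈ z → x ≈ z
  ≈-trans {x} {y} {z} (x⊆y , y⊆x) (y⊆z , z⊆y) =
    ⊆-trans {x} {y} {z} x⊆y y⊆z , ⊆-trans {z} {y} {x} z⊆y y⊆x

  ≈⇒≡ : {x y : Bip n} → x ≈ y → ∀ i j → rel x i j ≡ rel y i j
  ≈⇒≡ (x⊆y , y⊆x) i j = ≡-from-⇔ (x⊆y i j) (y⊆x i j)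

  ≡⇒⊆ : {x y : Bip n} → (∀ i j → rel x i j ≡ rel y i j) → x ⊆ y
  ≡⇒⊆ e i j h = ≡-trans (≡-sym (e i j)) h

  ≡⇒≈ : {x y : Bip n} → (∀ i j → rel x i j ≡ rel y i j) → x ≈ y
  ≡⇒≈ {x} {y} e = ≡⇒⊆ {x} {y} e , ≡⇒⊆ {y} {x} (λ i j → ≡-sym (e i j))

  ⊆-false : (w x : Bip n) → w ⊆ x → ∀ s t → rel x s t ≡ false → rel w s t ≡ false
  ⊆-false w x w⊆x s t h = ≢true⇒false (λ e → clash (w⊆x s t e) h)

  split-right : (x : Bip n) → ∀ i j k → rel x i k ≡ true → rel x i j ≡ false → rel x j k ≡ true
  split-right x i j k h e = ≢false⇒true (λ e' → clash h (cotrans x i j k e e'))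

  split-left : (x : Bip n) → ∀ i j k → rel x i k ≡ true → rel x j k ≡ false → rel x i j ≡ true
  split-left x i j k h e' = ≢false⇒true (λ e → clash h (cotrans x i j k e e'))

  has-pair? : (x : Bip n) → Dec (∃[ i ] ∃[ j ] rel x i j ≡ true)
  has-pair? x = any? (λ i → any? (λ j → rel x i j ≟ᵇ true))

  has-loop? : (x : Bip n) → Dec (∃[ b ] rel x b b ≡ true)
  has-loop? x = any? (λ b → rel x b b ≟ᵇ true)

  join-unique : {x x' y y' z z' : Bip n} → x ≈ x' → y ≈ y' →
                IsJoin x y z → IsJoin x' y' z' → z ≈ z'
  join-unique {x} {x'} {y} {y'} {z} {z'}
              (x⊆x' , x'⊆x) (y⊆y' , y'⊆y) (x⊆z , y⊆z , lub) (x'⊆z' , y'⊆z' , lub') =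
    lub z' (⊆-trans {x} {x'} {z'} x⊆x' x'⊆z') (⊆-trans {y} {y'} {z'} y⊆y' y'⊆z') ,
    lub' z (⊆-trans {x'} {x} {z} x'⊆x x⊆z) (⊆-trans {y'} {y} {z} y'⊆y y⊆z)

  meet-unique : {x x' y y' z z' : Bip n} → x ≈ x' → y ≈ y' →
                IsMeet x y z → IsMeet x' y' z' → z ≈ z'
  meet-unique {x} {x'} {y} {y'} {z} {z'}
              (x⊆x' , x'⊆x) (y⊆y' , y'⊆y) (z⊆x , z⊆y , glb) (z'⊆x' , z'⊆y' , glb') =
    glb' z (⊆-trans {z} {x} {x'} z⊆x x⊆x') (⊆-trans {z} {y} {y'} z⊆y y⊆y') ,
    glb z' (⊆-trans {z'} {x'} {x} z'⊆x' x'⊆x) (⊆-trans {z'} {y'} {y} z'⊆y' y'⊆y)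

  join-by-pairs : (x y q : Bip n) → x ⊆ q → y ⊆ q →
                  (∀ i j → rel q i j ≡ true → rel x i j ≡ true ⊎ rel y i j ≡ true) →
                  IsJoin x y q
  join-by-pairs x y q x⊆q y⊆q cover = x⊆q , y⊆q , λ w x⊆w y⊆w i j h →
    [ x⊆w i j , y⊆w i j ] (cover i j h)

  ji-below : (p x y : Bip n) → JoinIrreducible p → IsJoin x y p → p ⊆ x ⊎ p ⊆ y
  ji-below p x y (_ , irreducible) p=x∨y with irreducible x y p=x∨y
  ... | inj₁ p≈x = inj₁ (proj₁ p≈x)
  ... | inj₂ p≈y = inj₂ (proj₁ p≈y)

  ⋖-resp-≈ : {c p q : Bip n} → c ⋖ p → p ≈ q → c ⋖ q
  ⋖-resp-≈ {c} {p} {q} (c⊆p , p⊈c , between) (p⊆q , q⊆p) =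
    ⊆-trans {c} {p} {q} c⊆p p⊆q , (λ q⊆c → p⊈c (⊆-trans {p} {q} {c} p⊆q q⊆c)) , between'
    where
      between' : ∀ z → c ⊆ z → z ⊆ q → (z ≈ c) ⊎ (z ≈ q)
      between' z c⊆z z⊆q with between z c⊆z (⊆-trans {z} {q} {p} z⊆q q⊆p)
      ... | inj₁ z≈c = inj₁ z≈c
      ... | inj₂ z≈p = inj₂ (≈-trans {z} {p} {q} z≈p (p⊆q , q⊆p))

  ≈⇒⊑ : (p q : Bip n) → p ≈ q → p ⊑ q
  ≈⇒⊑ p q p≈q x y con-p θ C q-covers = con-p θ C p-covers
    where
      open IsCongruence C using (refl≈) renaming (trans to θ-trans)
      p-covers : ∀ c → c ⋖ p → θ c p
      p-covers c c⋖p = θ-trans c q p (q-covers c (⋖-resp-≈ {c} {p} {q} c⋖p p≈q))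
                                     (refl≈ q p (≈-sym {p} {q} p≈q))

  -- L × R is a bipartition as soon as every point lies in L or in R:
  -- transitivity is immediate, and a pair (s , u) ∈ L × R with (s , t), (t , u)
  -- missing would put t outside L ∪ R.
  rectangle : (L R : Fin n → Bool) → (∀ t → L t ∨ R t ≡ true) → Bip n
  rectangle L R covers = mkBip (λ s t → L s ∧ R t) tr cotr
    where
      tr : Transitive (λ s t → L s ∧ R t)
      tr s t u h₁ h₂ = ∧-intro (∧-conicalˡ (L s) (R t) h₁) (∧-conicalʳ (L t) (R u) h₂)
      cotr : CoTransitive (λ s t → L s ∧ R t)
      cotr s t u h₁ h₂ = ≢true⇒false λ h →
        clash (covers t) (∨-false (∧-falseˡ (∧-conicalʳ (L s) (R u) h) h₂)
                                  (∧-falseʳ (∧-conicalˡ (L s) (R u) h) h₁))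

  ⊥B : Bip n
  ⊥B = rectangle (λ _ → false) (λ _ → true) (λ _ → refl)

  ⊤B : Bip n
  ⊤B = rectangle (λ _ → true) (λ _ → true) (λ _ → refl)

  ⊥B-join : (x : Bip n) → IsJoin ⊥B x x
  ⊥B-join x = (λ _ _ ()) , ⊆-refl x , λ w _ x⊆w → x⊆w

  ⊤B-meet : (x : Bip n) → IsMeet ⊤B x x
  ⊤B-meet x = (λ _ _ _ → refl) , ⊆-refl x , λ w _ w⊆x → w⊆x

  meet-⊥B : (x : Bip n) → IsMeet x ⊥B ⊥B
  meet-⊥B x = (λ _ _ ()) , ⊆-refl ⊥B , λ w _ w⊆⊥ → w⊆⊥

  meet-⊤B : (x : Bip n) → IsMeet x ⊤B x
  meet-⊤B x = ⊆-refl x , (λ _ _ _ → refl) , λ w w⊆x _ → w⊆x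

  ∁ : (Fin n → Bool) → Fin n → Bool
  ∁ U i = not (U i)

  ⁅_⁆ : Fin n → Fin n → Bool
  ⁅ u ⁆ i = does (i ≟ u)

  atom : (U : Fin n → Bool) → Bip n
  atom U = rectangle (∁ U) U (λ t → ∨-inverseˡ (U t))

  atom-in : (U : Fin n → Bool) {s t : Fin n} → U s ≡ false → U t ≡ true → rel (atom U) s t ≡ true
  atom-in U hs ht rewrite hs | ht = refl

  atom-pair : (U : Fin n → Bool) {s t : Fin n} → rel (atom U) s t ≡ true → U s ≡ false × U t ≡ true
  atom-pair U {s} {t} h = not-true (∧-conicalˡ (∁ U s) (U t) h) , ∧-conicalʳ (∁ U s) (U t) h

  atom-out-source : (U : Fin n → Bool) {s t : Fin n} → U s ≡ true → rel (atom U) s t ≡ false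
  atom-out-source U hs rewrite hs = refl

  atom-out-target : (U : Fin n → Bool) {s t : Fin n} → U t ≡ false → rel (atom U) s t ≡ false
  atom-out-target U {s} ht rewrite ht = ∧-zeroʳ (∁ U s)

  -- A(U) is an atom: a subrelation w ⊆ A(U) with one pair (i , j) has every pair
  -- (k , l) of A(U), for otherwise cotransitivity along i → k → l → j would remove
  -- (i , j) from w.
  atom-minimal : (U : Fin n → Bool) (w : Bip n) → w ⊆ atom U →
                 ∀ i j → rel w i j ≡ true → atom U ⊆ w
  atom-minimal U w w⊆A i j wij k l Akl with rel w k l in wkl
  ... | true  = refl
  ... | false = ⊥-elim (clash wij (cotrans w i l j wil wlj))
    where
      wil : rel w i l ≡ false
      wil = cotrans w i k l (⊆-false w (atom U) w⊆A i k (atom-out-target U (proj₁ (atom-pair U Akl)))) wkl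
      wlj : rel w l j ≡ false
      wlj = ⊆-false w (atom U) w⊆A l j (atom-out-source U (proj₂ (atom-pair U Akl)))

  ⊥⋖atom : (U : Fin n → Bool) {u v : Fin n} → U u ≡ true → U v ≡ false → ⊥B ⋖ atom U
  ⊥⋖atom U {u} {v} hu hv =
    (λ _ _ ()) , (λ A⊆⊥ → no-pair-in-⊥ (A⊆⊥ v u (atom-in U hv hu))) , between
    where
      no-pair-in-⊥ : false ≡ true → ⊥
      no-pair-in-⊥ ()
      between : ∀ z → ⊥B ⊆ z → z ⊆ atom U → (z ≈ ⊥B) ⊎ (z ≈ atom U)
      between z _ z⊆A with has-pair? z
      ... | yes (i , j , zij) = inj₂ (z⊆A , atom-minimal U z z⊆A i j zij)
      ... | no no-pair        = inj₁ ((λ i j zij → ⊥-elim (no-pair (i , j , zij))) , (λ _ _ ()))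

  bipartite-⊥⋖ : (q : Bip n) → Bipartite q → ⊥B ⋖ q
  bipartite-⊥⋖ q (U , (u , hu) , (v , hv) , q≡A) =
    ⋖-resp-≈ {⊥B} {atom U} {q} (⊥⋖atom U hu hv)
             (≡⇒≈ {atom U} {q} (λ i j → ≡-sym (q≡A i j)))

  meet-atom : (W : Fin n → Bool) (y : Bip n) → ¬ (atom W ⊆ y) → IsMeet y (atom W) ⊥B
  meet-atom W y A⊈y = (λ _ _ ()) , (λ _ _ ()) , λ w w⊆y w⊆A i j wij →
    ⊥-elim (A⊈y (⊆-trans {atom W} {w} {y} (atom-minimal W w w⊆A i j wij) w⊆y))

  -- For proper U, A(U) ∨ A(∁ U) = ⊤: a pair inside U or inside ∁ U is obtained by
  -- passing through v ∉ U or u ∈ U.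
  join-complementary : (U : Fin n → Bool) {u v : Fin n} → U u ≡ true → U v ≡ false →
                       IsJoin (atom U) (atom (∁ U)) ⊤B
  join-complementary U {u} {v} hu hv = (λ _ _ _ → refl) , (λ _ _ _ → refl) , lub
    where
      lub : ∀ w → atom U ⊆ w → atom (∁ U) ⊆ w → ⊤B ⊆ w
      lub w A⊆w A∁⊆w i j _ with U i in ui | U j in uj
      ... | false | true  = A⊆w i j (atom-in U ui uj)
      ... | true  | false = A∁⊆w i j (atom-in (∁ U) (cong not ui) (cong not uj))
      ... | false | false = trans w i u j (A⊆w i u (atom-in U ui hu))
                                          (A∁⊆w u j (atom-in (∁ U) (cong not hu) (cong not uj)))
      ... | true  | true  = trans w i v j (A∁⊆w i v (atom-in (∁ U) (cong not ui) (cong not hv)))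
                                          (A⊆w v j (atom-in U hv uj))

  atom-⊈ : (V W : Fin n → Bool) {r s : Fin n} → V s ≡ true → V r ≡ false →
           W s ≡ false ⊎ W r ≡ true → ¬ (atom V ⊆ atom W)
  atom-⊈ V W {r} {s} hs hr W-fails A⊆A' with A⊆A' r s (atom-in V hr hs) | W-fails
  ... | A'rs | inj₁ ws = clash A'rs (atom-out-target W ws)
  ... | A'rs | inj₂ wr = clash A'rs (atom-out-source W wr)

  -- Given a third point w, a proper U (u ∈ U, v ∉ U) has a second proper U'
  -- (u ∈ U', v ∉ U') with A(∁ U) ⊄ A(∁ U'): take U' = {u} if w ∈ U and
  -- U' = ∁ {v} if w ∉ U.
  another-cut : ThreePoints n → (U : Fin n → Bool) {u v : Fin n} → U u ≡ true → U v ≡ false →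
                Σ[ U' ∈ (Fin n → Bool) ]
                  U' u ≡ true × U' v ≡ false × ¬ (atom (∁ U) ⊆ atom (∁ U'))
  another-cut three U {u} {v} hu hv with three u v
  ... | w , w≢u , w≢v with U w in uw
  ...   | true  = ⁅ u ⁆ , dec-true (u ≟ u) refl , dec-false (v ≟ u) v≢u ,
                  atom-⊈ (∁ U) (∁ ⁅ u ⁆) {r = w} {s = v} (cong not hv) (cong not uw)
                         (inj₂ (cong not (dec-false (w ≟ u) w≢u)))
    where
      v≢u : v ≢ u
      v≢u refl = clash hu hv
  ...   | false = ∁ ⁅ v ⁆ , cong not (dec-false (u ≟ v) u≢v) , cong not (dec-true (v ≟ v) refl) ,
                  atom-⊈ (∁ U) (∁ (∁ ⁅ v ⁆)) {r = u} {s = w} (cong not uw) (cong not hu)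
                         (inj₁ (cong not (cong not (dec-false (w ≟ v) w≢v))))
    where
      u≢v : u ≢ v
      u≢v refl = clash hu hv

  module Collapse {θ : Bip n → Bip n → Set} (C : IsCongruence θ) where
    open IsCongruence C renaming (refl≈ to θ-≈; sym to θ-sym; trans to θ-trans)

    θ-refl : ∀ x → θ x x
    θ-refl x = θ-≈ x x (≈-refl x)

    -- Relating ⊥ and ⊤ relates everything (meet both with x).
    θ-all : θ ⊥B ⊤B → ∀ x y → θ x y
    θ-all ⊥θ⊤ x y = θ-trans x ⊥B y (θ-sym ⊥B x (⊥θ x)) (⊥θ y)
      where
        ⊥θ : ∀ x → θ ⊥B x
        ⊥θ x = meet-compat x x ⊥B ⊤B ⊥B x (θ-refl x) ⊥θ⊤ (meet-⊥B x) (meet-⊤B x)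

    -- θ ⊥ A(U) gives θ A(∁ U) ⊤, joining both sides with A(∁ U).
    join-up : (U : Fin n → Bool) {u v : Fin n} → U u ≡ true → U v ≡ false →
              θ ⊥B (atom U) → θ (atom (∁ U)) ⊤B
    join-up U hu hv h =
      join-compat ⊥B (atom U) A∁ A∁ A∁ ⊤B h (θ-refl A∁)
                  (⊥B-join A∁) (join-complementary U hu hv)
      where
        A∁ : Bip n
        A∁ = atom (∁ U)

    -- θ A(V) ⊤ gives θ ⊥ A(W) for every atom A(W) ⊄ A(V), meeting both sides with A(W).
    meet-down : (V W : Fin n → Bool) → ¬ (atom W ⊆ atom V) → θ (atom V) ⊤B → θ ⊥B (atom W)
    meet-down V W W⊈V h =
      meet-compat (atom V) ⊤B (atom W) (atom W) ⊥B (atom W) h (θ-refl (atom W))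
                  (meet-atom W (atom V) W⊈V) (⊤B-meet (atom W))

    -- Given a third point, relating ⊥ to one proper atom A(U) collapses θ:
    -- θ ⊥ A(U) ⟹ θ A(∁ U) ⊤ ⟹ θ ⊥ A(U') ⟹ θ A(∁ U') ⊤ ⟹ θ ⊥ A(∁ U),
    -- and θ ⊥ A(∁ U), θ A(∁ U) ⊤ give θ ⊥ ⊤.
    collapse : ThreePoints n → (U : Fin n → Bool) {u v : Fin n} → U u ≡ true → U v ≡ false →
               θ ⊥B (atom U) → θ ⊥B ⊤B
    collapse three U hu hv h with another-cut three U hu hv
    ... | U' , hu' , hv' , ∁U⊈∁U' = θ-trans ⊥B (atom (∁ U)) ⊤B ⊥θA∁U A∁Uθ⊤
      where
        A∁Uθ⊤ : θ (atom (∁ U)) ⊤B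
        A∁Uθ⊤ = join-up U hu hv h
        ⊥θA' : θ ⊥B (atom U')
        ⊥θA' = meet-down (∁ U) U' (atom-⊈ U' (∁ U) hu' hv' (inj₁ (cong not hu))) A∁Uθ⊤
        ⊥θA∁U : θ ⊥B (atom (∁ U))
        ⊥θA∁U = meet-down (∁ U') (∁ U) ∁U⊈∁U' (join-up U' hu' hv' ⊥θA')

  con-bipartite-total : ThreePoints n → (q : Bip n) → Bipartite q → ∀ x y → con q x y
  con-bipartite-total three q (U , (u , hu) , (v , hv) , q≡A) x y θ C q-covers =
    θ-all (collapse three U hu hv ⊥θA) x y
    where
      open Collapse C
      open IsCongruence C using (refl≈) renaming (trans to θ-trans)
      q≈A : q ≈ atom U
      q≈A = ≡⇒≈ {q} {atom U} q≡A
      ⊥θA : θ ⊥B (atom U)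
      ⊥θA = θ-trans ⊥B q (atom U) (q-covers ⊥B (bipartite-⊥⋖ q (U , (u , hu) , (v , hv) , q≡A)))
                    (refl≈ q (atom U) q≈A)

  -- Keeping only the pairs (s , t) of q with L s is again a
  -- bipartition when L is source-stable: whenever s has a pair (s , u) but not
  -- (s , t), L passes from s to t.  Dually for targets.
  SourceStable : (q : Bip n) → (Fin n → Bool) → Set
  SourceStable q L = ∀ s t u → rel q s u ≡ true → L s ≡ true → rel q s t ≡ false → L t ≡ true

  TargetStable : (q : Bip n) → (Fin n → Bool) → Set
  TargetStable q R = ∀ s t u → rel q s u ≡ true → R u ≡ true → rel q t u ≡ false → R t ≡ true

  restrict-source : (q : Bip n) (L : Fin n → Bool) → SourceStable q L → Bip n
  restrict-source q L stable = mkBip (λ s t → rel q s t ∧ L s) tr cotr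
    where
      tr : Transitive (λ s t → rel q s t ∧ L s)
      tr s t u h₁ h₂ =
        ∧-intro (trans q s t u (∧-conicalˡ (rel q s t) (L s) h₁) (∧-conicalˡ (rel q t u) (L t) h₂))
                (∧-conicalʳ (rel q s t) (L s) h₁)
      cotr : CoTransitive (λ s t → rel q s t ∧ L s)
      cotr s t u h₁ h₂ = ≢true⇒false λ h →
        let qsu = ∧-conicalˡ (rel q s u) (L s) h
            Ls  = ∧-conicalʳ (rel q s u) (L s) h
            qst = ∧-falseˡ Ls h₁
            qtu = ∧-falseˡ (stable s t u qsu Ls qst) h₂
        in clash qsu (cotrans q s t u qst qtu)

  restrict-target : (q : Bip n) (R : Fin n → Bool) → TargetStable q R → Bip n
  restrict-target q R stable = mkBip (λ s t → rel q s t ∧ R t) tr cotr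
    where
      tr : Transitive (λ s t → rel q s t ∧ R t)
      tr s t u h₁ h₂ =
        ∧-intro (trans q s t u (∧-conicalˡ (rel q s t) (R t) h₁) (∧-conicalˡ (rel q t u) (R u) h₂))
                (∧-conicalʳ (rel q t u) (R u) h₂)
      cotr : CoTransitive (λ s t → rel q s t ∧ R t)
      cotr s t u h₁ h₂ = ≢true⇒false λ h →
        let qsu = ∧-conicalˡ (rel q s u) (R u) h
            Ru  = ∧-conicalʳ (rel q s u) (R u) h
            qtu = ∧-falseˡ Ru h₂
            qst = ∧-falseˡ (stable s t u qsu Ru qtu) h₁
        in clash qsu (cotrans q s t u qst qtu)

  -- Splitting a join-irreducible q: if every pair (s , t) has L s or R t, then q is
  -- the join of its two restrictions, so one of them is all of q.
  ji-split : (q : Bip n) → JoinIrreducible q →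
             (L : Fin n → Bool) → SourceStable q L → (R : Fin n → Bool) → TargetStable q R →
             (∀ s t → rel q s t ≡ true → L s ≡ true ⊎ R t ≡ true) →
             (∀ s t → rel q s t ≡ true → L s ≡ true) ⊎
             (∀ s t → rel q s t ≡ true → R t ≡ true)
  ji-split q ji L stL R stR cover
    with ji-below q qL qR ji (join-by-pairs qL qR q
                                (λ s t h → ∧-conicalˡ (rel q s t) (L s) h)
                                (λ s t h → ∧-conicalˡ (rel q s t) (R t) h)
                                (λ s t h → ⊎-map (∧-intro h) (∧-intro h) (cover s t h)))
    where
      qL qR : Bip n
      qL = restrict-source q L stL
      qR = restrict-target q R stR
  ... | inj₁ q⊆qL = inj₁ λ s t h → ∧-conicalʳ (rel q s t) (L s) (q⊆qL s t h)
  ... | inj₂ q⊆qR = inj₂ λ s t h → ∧-conicalʳ (rel q s t) (R t) (q⊆qR s t h)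

  -- In a join-irreducible q, a loop-free point x that is the target of a pair is
  -- passed on the left by all pairs: each pair (s , t) has (s , x) or (x , t), and
  -- "all have (x , t)" would give the loop (x , x).
  pass-left : (q : Bip n) → JoinIrreducible q → ∀ {s} x → rel q x x ≡ false → rel q s x ≡ true →
              ∀ s' t' → rel q s' t' ≡ true → rel q s' x ≡ true
  pass-left q ji {s} x qxx qsx
    with ji-split q ji (λ s → rel q s x) (λ s t _ _ qsx qst → split-right q s t x qsx qst)
                       (λ t → rel q x t) (λ s t u _ qxu qtu → split-left q x t u qxu qtu) cover
    where
      cover : ∀ s t → rel q s t ≡ true → rel q s x ≡ true ⊎ rel q x t ≡ true
      cover s t h with bool-split (rel q s x)
      ... | inj₁ qsx = inj₁ qsx
      ... | inj₂ qsx = inj₂ (split-right q s x t h qsx)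
  ... | inj₁ all-left  = all-left
  ... | inj₂ all-right = ⊥-elim (clash (all-right s x qsx) qxx)

  -- A loop-free join-irreducible q is bipartite: for a pair (i , j), q is the atom
  -- cut by U = q(i , ·), since by pass-left a pair (s , t) has (i , t) and not (i , s).
  loop-free-bipartite : (q : Bip n) → JoinIrreducible q → (∀ x → rel q x x ≡ false) → Bipartite q
  loop-free-bipartite q ji loop-free with has-pair? q
  ... | no no-pair = ⊥-elim (proj₁ ji (λ _ i j h → ⊥-elim (no-pair (i , j , h))))
  ... | yes (i , j , qij) =
    rel q i , (j , qij) , (i , loop-free i) , λ s t → ≡-from-⇔ (to s t) (from s t)
    where
      to : ∀ s t → rel q s t ≡ true → not (rel q i s) ∧ rel q i t ≡ true
      to s t qst = ∧-intro (not-intro qis) (pass-left q ji t (loop-free t) qst i j qij)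
        where
          qis : rel q i s ≡ false
          qis = ≢true⇒false λ qis → clash (pass-left q ji s (loop-free s) qis s t qst) (loop-free s)
      from : ∀ s t → not (rel q i s) ∧ rel q i t ≡ true → rel q s t ≡ true
      from s t h = split-right q i s t (∧-conicalʳ (not (rel q i s)) (rel q i t) h)
                                       (not-true (∧-conicalˡ (not (rel q i s)) (rel q i t) h))

  clepsydra : (a : Fin n) (U : Fin n → Bool) → Bip n
  clepsydra a U = rectangle (λ s → does (s ≟ a) ∨ not (U s)) (λ t → does (t ≟ a) ∨ U t) covers
    where
      covers : ∀ t → (does (t ≟ a) ∨ not (U t)) ∨ (does (t ≟ a) ∨ U t) ≡ true
      covers t with does (t ≟ a)
      ... | true  = refl
      ... | false = ∨-inverseˡ (U t)

  clepsydra-cong : (a : Fin n) (U V : Fin n → Bool) → (∀ j → j ≢ a → U j ≡ V j) →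
                   ∀ s t → rel (clepsydra a U) s t ≡ rel (clepsydra a V) s t
  clepsydra-cong a U V U≡V s t with s ≟ a | t ≟ a
  ... | yes _  | yes _  = refl
  ... | yes _  | no t≢a = U≡V t t≢a
  ... | no s≢a | yes _  = cong (λ b → not b ∧ true) (U≡V s s≢a)
  ... | no s≢a | no t≢a = cong₂ (λ b c → not b ∧ c) (U≡V s s≢a) (U≡V t t≢a)

  -- If q has a loop at a, the clepsydra with apex a and set q(a , ·) lies below q:
  -- its pairs run into a (by the loop or by cotransitivity) and then out of a.
  clepsydra-below : (q : Bip n) (a : Fin n) → rel q a a ≡ true → clepsydra a (rel q a) ⊆ q
  clepsydra-below q a qaa s t h =
    trans q s a t (into-apex (∧-conicalˡ (L s) (R t) h)) (out-of-apex (∧-conicalʳ (L s) (R t) h))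
    where
      L R : Fin n → Bool
      L s = does (s ≟ a) ∨ not (rel q a s)
      R t = does (t ≟ a) ∨ rel q a t
      into-apex : L s ≡ true → rel q s a ≡ true
      into-apex h with ∨-true {does (s ≟ a)} h
      ... | inj₁ s≡a = subst (λ w → rel q w a ≡ true) (≡-sym (does-witness (s ≟ a) s≡a)) qaa
      ... | inj₂ qas = split-right q a s a qaa (not-true qas)
      out-of-apex : R t ≡ true → rel q a t ≡ true
      out-of-apex h with ∨-true {does (t ≟ a)} h
      ... | inj₁ t≡a = subst (λ w → rel q a w ≡ true) (≡-sym (does-witness (t ≟ a) t≡a)) qaa
      ... | inj₂ qat = qat

  -- A join-irreducible q with a loop at a has all pairs (s , t) entering a, i.e.
  -- (s , a) ∈ q: each pair has (s , a) or not (t , a), and "none has (t , a)" fails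
  -- at the loop.
  loop-pass-left : (q : Bip n) → JoinIrreducible q → ∀ a → rel q a a ≡ true →
                   ∀ s t → rel q s t ≡ true → rel q s a ≡ true
  loop-pass-left q ji a qaa
    with ji-split q ji (λ s → rel q s a) (λ s t _ _ qsa qst → split-right q s t a qsa qst)
                       (λ t → not (rel q t a))
                       (λ s t u _ qua qtu → not-intro (cotrans q t u a qtu (not-true qua)))
                       cover
    where
      cover : ∀ s t → rel q s t ≡ true → rel q s a ≡ true ⊎ not (rel q t a) ≡ true
      cover s t h with bool-split (rel q t a)
      ... | inj₁ qta = inj₁ (trans q s t a h qta)
      ... | inj₂ qta = inj₂ (not-intro qta)
  ... | inj₁ all-enter = all-enter
  ... | inj₂ none-back = ⊥-elim (clash qaa (not-true (none-back a a qaa)))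

  off-apex : (q : Bip n) (a : Fin n) → (∀ s t → rel q s t ≡ true → rel q s a ≡ true) → Bip n
  off-apex q a enter = restrict-source q (λ s → not (does (s ≟ a))) stable
    where
      stable : SourceStable q (λ s → not (does (s ≟ a)))
      stable s t u qsu _ qst = not-intro (≢true⇒false λ t≡a →
        clash (enter s u qsu) (subst (λ w → rel q s w ≡ false) (does-witness (t ≟ a) t≡a) qst))

  -- A join-irreducible q with a loop at a is the clepsydra with apex a and set
  -- q(a , ·): q is its join with off-apex q a, which misses the loop.
  loop-clepsydra : (q : Bip n) → JoinIrreducible q → ∀ a → rel q a a ≡ true →
                   q ≈ clepsydra a (rel q a)
  loop-clepsydra q ji a qaa
    with ji-below q K Y ji (join-by-pairs K Y q (clepsydra-below q a qaa)
                              (λ s t h → ∧-conicalˡ (rel q s t) (not (does (s ≟ a))) h) cover)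
    where
      K Y : Bip n
      K = clepsydra a (rel q a)
      Y = off-apex q a (loop-pass-left q ji a qaa)
      cover : ∀ s t → rel q s t ≡ true → rel K s t ≡ true ⊎ rel Y s t ≡ true
      cover s t h with s ≟ a
      ... | yes refl = inj₁ (∨-introʳ h)
      ... | no _     = inj₂ (∧-intro h refl)
  ... | inj₁ q⊆K = q⊆K , clepsydra-below q a qaa
  ... | inj₂ q⊆Y = ⊥-elim (clash (dec-true (a ≟ a) refl)
                                 (not-true (∧-conicalʳ (rel q a a) (not (does (a ≟ a))) (q⊆Y a a qaa))))

  bipartite-or-loop : (q : Bip n) → JoinIrreducible q → Bipartite q ⊎ (∃[ a ] rel q a a ≡ true)
  bipartite-or-loop q ji with has-loop? q
  ... | yes loop   = inj₂ loop
  ... | no no-loop = inj₁ (loop-free-bipartite q ji (λ b → ≢true⇒false (λ qbb → no-loop (b , qbb))))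

  -- Two bipartitions are related
  -- when they agree away from the entry (a , a) and, if they differ there, both have
  -- the row and column of a prescribed by U ("shaped").  The only identifications
  -- are thus between a shaped element with the apex loop and the same element without it.
  module ApexCongruence (a : Fin n) (U : Fin n → Bool) where

    Apex : Fin n → Fin n → Set
    Apex i j = (i ≡ a) × (j ≡ a)

    apex? : ∀ i j → Dec (Apex i j)
    apex? i j with i ≟ a | j ≟ a
    ... | yes i≡a | yes j≡a = yes (i≡a , j≡a)
    ... | no i≢a  | _       = no (λ apex → i≢a (proj₁ apex))
    ... | yes _   | no j≢a  = no (λ apex → j≢a (proj₂ apex))

    isApex : Fin n → Fin n → Bool
    isApex i j = does (apex? i j)

    -- Case splits on the apex that leave isApex untouched in the goal.
    at-apex? : ∀ t → t ≡ a ⊎ t ≢ a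
    at-apex? t with t ≟ a
    ... | yes t≡a = inj₁ t≡a
    ... | no t≢a  = inj₂ t≢a

    apex-cases : ∀ i j → Apex i j ⊎ ¬ Apex i j
    apex-cases i j with apex? i j
    ... | yes apex = inj₁ apex
    ... | no off   = inj₂ off

    apex-entry : (x : Bip n) → ∀ {i j} → Apex i j → rel x i j ≡ rel x a a
    apex-entry x (refl , refl) = refl

    _≃_ : Bip n → Bip n → Set
    x ≃ y = ∀ i j → ¬ Apex i j → rel x i j ≡ rel y i j

    ≃-sym : (x y : Bip n) → x ≃ y → y ≃ x
    ≃-sym x y x≃y i j off = ≡-sym (x≃y i j off)

    ≈⇒≃ : (x y : Bip n) → x ≈ y → x ≃ y
    ≈⇒≃ x y x≈y i j _ = ≈⇒≡ {x} {y} x≈y i j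

    ≃-apex-≈ : (x y : Bip n) → x ≃ y → rel x a a ≡ rel y a a → x ≈ y
    ≃-apex-≈ x y x≃y xa≡ya = ≡⇒≈ {x} {y} entries
      where
        entries : ∀ i j → rel x i j ≡ rel y i j
        entries i j with apex-cases i j
        ... | inj₁ apex = ≡-trans (apex-entry x apex) (≡-trans xa≡ya (≡-sym (apex-entry y apex)))
        ... | inj₂ off  = x≃y i j off

    _⊆ₐ_ : Bip n → Bip n → Set
    x ⊆ₐ y = ∀ i j → rel x i j ≡ true → rel y i j ≡ true ⊎ Apex i j

    ⊆ₐ-antisym : (x y : Bip n) → x ⊆ₐ y → y ⊆ₐ x → x ≃ y
    ⊆ₐ-antisym x y x⊆y y⊆x i j off = ≡-from-⇔ (away (x⊆y i j)) (away (y⊆x i j))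
      where
        away : {A : Set} {b : Bool} → (b ≡ true → A ⊎ Apex i j) → b ≡ true → A
        away f h with f h
        ... | inj₁ r    = r
        ... | inj₂ apex = ⊥-elim (off apex)

    Shaped : Bip n → Set
    Shaped x = ∀ j → j ≢ a → (rel x a j ≡ U j) × (rel x j a ≡ not (U j))

    shaped-≃ : (x y : Bip n) → x ≃ y → Shaped x → Shaped y
    shaped-≃ x y x≃y sh j j≢a =
      ≡-trans (≡-sym (x≃y a j (λ apex → j≢a (proj₂ apex)))) (proj₁ (sh j j≢a)) ,
      ≡-trans (≡-sym (x≃y j a (λ apex → j≢a (proj₁ apex)))) (proj₂ (sh j j≢a))

    shaped-comparable : (x : Bip n) → Shaped x → ∀ j → j ≢ a →
                        rel x a j ≡ true ⊎ rel x j a ≡ true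
    shaped-comparable x sh j j≢a with U j | sh j j≢a
    ... | true  | xaj , _ = inj₁ xaj
    ... | false | _ , xja = inj₂ xja

    shaped-exclusive : (x : Bip n) → Shaped x → ∀ j → j ≢ a →
                       rel x a j ≡ true → rel x j a ≡ true → ⊥
    shaped-exclusive x sh j j≢a xaj xja with U j | sh j j≢a
    ... | true  | _ , xja≡false = clash xja xja≡false
    ... | false | xaj≡false , _ = clash xaj xaj≡false

    shaped-from : (z : Bip n) → ∀ j → (U j ≡ true → rel z a j ≡ true × rel z j a ≡ false) →
                  (U j ≡ false → rel z a j ≡ false × rel z j a ≡ true) →
                  (rel z a j ≡ U j) × (rel z j a ≡ not (U j))
    shaped-from z j if-in if-out with bool-split (U j)
    ... | inj₁ uj = ≡-trans (proj₁ (if-in uj)) (≡-sym uj) ,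
                    ≡-trans (proj₂ (if-in uj)) (cong not (≡-sym uj))
    ... | inj₂ uj = ≡-trans (proj₁ (if-out uj)) (≡-sym uj) ,
                    ≡-trans (proj₂ (if-out uj)) (cong not (≡-sym uj))

    shaped-up : (w z : Bip n) → Shaped w → w ⊆ z → rel z a a ≡ false → Shaped z
    shaped-up w z sh w⊆z zaa j j≢a = shaped-from z j
      (λ uj → let zaj = w⊆z a j (≡-trans (proj₁ (sh j j≢a)) uj)
              in zaj , ≢true⇒false (λ zja → clash (trans z a j a zaj zja) zaa))
      (λ uj → let zja = w⊆z j a (≡-trans (proj₂ (sh j j≢a)) (cong not uj))
              in ≢true⇒false (λ zaj → clash (trans z a j a zaj zja) zaa) , zja)

    shaped-down : (w z : Bip n) → Shaped w → z ⊆ w → rel z a a ≡ true → Shaped z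
    shaped-down w z sh z⊆w zaa j j≢a = shaped-from z j
      (λ uj → let zja = ⊆-false z w z⊆w j a (≡-trans (proj₂ (sh j j≢a)) (cong not uj))
              in split-left z a j a zaa zja , zja)
      (λ uj → let zaj = ⊆-false z w z⊆w a j (≡-trans (proj₁ (sh j j≢a)) uj)
              in zaj , split-right z a j a zaa zaj)

    isApex-false : ∀ {i j} → ¬ Apex i j → isApex i j ≡ false
    isApex-false {i} {j} off = dec-false (apex? i j) off

    off-apex-entry : (x : Bip n) → ∀ {i j} → ¬ Apex i j →
                     rel x i j ∨ isApex i j ≡ true → rel x i j ≡ true
    off-apex-entry x {i} {j} off h with ∨-true {rel x i j} h
    ... | inj₁ xij = xij
    ... | inj₂ apex = ⊥-elim (clash apex (isApex-false off))

    -- Adding the apex loop to a shaped element gives a bipartition: a missing pair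
    -- around the new pair (a , a) would be a point unrelated to a, excluded by shape.
    with-apex : (z : Bip n) → Shaped z → Bip n
    with-apex z sh = mkBip (λ s t → rel z s t ∨ isApex s t) tr cotr
      where
        tr : Transitive (λ s t → rel z s t ∨ isApex s t)
        tr s t u h₁ h₂ with apex-cases s t | apex-cases t u
        ... | inj₁ (refl , refl) | _                  = h₂
        ... | inj₂ _             | inj₁ (refl , refl) = h₁
        ... | inj₂ st-off        | inj₂ tu-off        =
          ∨-introˡ (trans z s t u (off-apex-entry z st-off h₁) (off-apex-entry z tu-off h₂))
        cotr : CoTransitive (λ s t → rel z s t ∨ isApex s t)
        cotr s t u h₁ h₂ =
          ∨-false (cotrans z s t u (∨-conicalˡ (rel z s t) _ h₁) (∨-conicalˡ (rel z t u) _ h₂))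
                  (isApex-false su-off)
          where
            su-off : ¬ Apex s u
            su-off (refl , refl) with at-apex? t
            ... | inj₁ refl = clash (dec-true (apex? a a) (refl , refl)) (∨-conicalʳ (rel z a a) _ h₁)
            ... | inj₂ t≢a with shaped-comparable z sh t t≢a
            ...   | inj₁ zat = clash zat (∨-conicalˡ (rel z a t) _ h₁)
            ...   | inj₂ zta = clash zta (∨-conicalˡ (rel z t a) _ h₂)

    -- Removing the apex loop from a shaped element gives a bipartition: a pair
    -- (a , t) , (t , a) composing to the removed pair is excluded by shape.
    without-apex : (z : Bip n) → Shaped z → Bip n
    without-apex z sh = mkBip (λ s t → rel z s t ∧ not (isApex s t)) tr cotr
      where
        tr : Transitive (λ s t → rel z s t ∧ not (isApex s t))
        tr s t u h₁ h₂ = ∧-intro (trans z s t u zst ztu) (not-intro (isApex-false su-off))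
          where
            zst : rel z s t ≡ true
            zst = ∧-conicalˡ (rel z s t) (not (isApex s t)) h₁
            ztu : rel z t u ≡ true
            ztu = ∧-conicalˡ (rel z t u) (not (isApex t u)) h₂
            su-off : ¬ Apex s u
            su-off (refl , refl) = shaped-exclusive z sh t t≢a zst ztu
              where
                t≢a : t ≢ a
                t≢a t≡a = clash (dec-true (apex? a t) (refl , t≡a))
                                (not-true (∧-conicalʳ (rel z a t) (not (isApex a t)) h₁))
        cotr : CoTransitive (λ s t → rel z s t ∧ not (isApex s t))
        cotr s t u h₁ h₂ = ≢true⇒false λ h → missing (∧-conicalˡ (rel z s u) (not (isApex s u)) h)
                                                    (not-true (∧-conicalʳ (rel z s u) (not (isApex s u)) h))
          where
            kept : ∀ {i j} → rel z i j ∧ not (isApex i j) ≡ false → ¬ Apex i j →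
                   rel z i j ≡ false
            kept {i} {j} e off with ∧-false {rel z i j} e
            ... | inj₁ zij  = zij
            ... | inj₂ apex = ⊥-elim (off (does-witness (apex? i j) (not-false apex)))
            missing : rel z s u ≡ true → isApex s u ≡ false → ⊥
            missing zsu su-off with apex-cases s t | apex-cases t u
            ... | inj₁ (refl , refl) | _                  = clash (∧-intro zsu (not-intro su-off)) h₂
            ... | inj₂ _             | inj₁ (refl , refl) = clash (∧-intro zsu (not-intro su-off)) h₁
            ... | inj₂ st-off        | inj₂ tu-off        =
              clash zsu (cotrans z s t u (kept h₁ st-off) (kept h₂ tu-off))

    apex-in : (z : Bip n) (sh : Shaped z) → rel (with-apex z sh) a a ≡ true
    apex-in z sh = ∨-introʳ {rel z a a} (dec-true (apex? a a) (refl , refl))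

    apex-out : (z : Bip n) (sh : Shaped z) → rel (without-apex z sh) a a ≡ false
    apex-out z sh rewrite dec-true (apex? a a) (refl , refl) = ∧-zeroʳ (rel z a a)

    apex-closure : (w z : Bip n) → Shaped w → w ⊆ z →
                   Σ[ z⁺ ∈ Bip n ] (z ⊆ z⁺) × (z⁺ ⊆ₐ z) × (rel z⁺ a a ≡ true)
    apex-closure w z sh w⊆z with bool-split (rel z a a)
    ... | inj₁ zaa = z , ⊆-refl z , (λ i j h → inj₁ h) , zaa
    ... | inj₂ zaa = with-apex z shz , (λ i j h → ∨-introˡ h) , back , apex-in z shz
      where
        shz : Shaped z
        shz = shaped-up w z sh w⊆z zaa
        back : with-apex z shz ⊆ₐ z
        back i j h with ∨-true {rel z i j} h
        ... | inj₁ zij  = inj₁ zij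
        ... | inj₂ apex = inj₂ (does-witness (apex? i j) apex)

    apex-interior : (w z : Bip n) → Shaped w → z ⊆ w →
                    Σ[ z⁻ ∈ Bip n ] (z⁻ ⊆ z) × (z ⊆ₐ z⁻) × (rel z⁻ a a ≡ false)
    apex-interior w z sh z⊆w with bool-split (rel z a a)
    ... | inj₂ zaa = z , ⊆-refl z , (λ i j h → inj₁ h) , zaa
    ... | inj₁ zaa =
      without-apex z shz , (λ i j h → ∧-conicalˡ (rel z i j) _ h) , forth , apex-out z shz
      where
        shz : Shaped z
        shz = shaped-down w z sh z⊆w zaa
        forth : z ⊆ₐ without-apex z shz
        forth i j h with apex-cases i j
        ... | inj₁ apex = inj₂ apex
        ... | inj₂ off  = inj₁ (∧-intro h (not-intro (isApex-false off)))

    ≃-⊆-apexed : (x x' v : Bip n) → x ≃ x' → x ⊆ v → rel v a a ≡ true → x' ⊆ v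
    ≃-⊆-apexed x x' v x≃x' x⊆v vaa i j h with apex-cases i j
    ... | inj₁ apex = ≡-trans (apex-entry v apex) vaa
    ... | inj₂ off  = x⊆v i j (≡-trans (x≃x' i j off) h)

    ≃-⊇-apexless : (x x' v : Bip n) → x ≃ x' → v ⊆ x → rel v a a ≡ false → v ⊆ x'
    ≃-⊇-apexless x x' v x≃x' v⊆x vaa i j h with apex-cases i j
    ... | inj₁ apex = ⊥-elim (clash (≡-trans (≡-sym (apex-entry v apex)) h) vaa)
    ... | inj₂ off  = ≡-trans (≡-sym (x≃x' i j off)) (v⊆x i j h)

    join-⊆ₐ : (x x' y y' z z' w : Bip n) → x ≃ x' → y ≃ y' → IsJoin x y z → IsJoin x' y' z' →
              Shaped w → w ⊆ z → z' ⊆ₐ z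
    join-⊆ₐ x x' y y' z z' w x≃x' y≃y' (x⊆z , y⊆z , _) (_ , _ , lub') sh w⊆z i j h
      with apex-closure w z sh w⊆z
    ... | z⁺ , z⊆z⁺ , z⁺⊆ₐz , z⁺aa =
      z⁺⊆ₐz i j (lub' z⁺ (≃-⊆-apexed x x' z⁺ x≃x' (⊆-trans {x} {z} {z⁺} x⊆z z⊆z⁺) z⁺aa)
                         (≃-⊆-apexed y y' z⁺ y≃y' (⊆-trans {y} {z} {z⁺} y⊆z z⊆z⁺) z⁺aa)
                         i j h)

    meet-⊆ₐ : (x x' y y' z z' w : Bip n) → x ≃ x' → y ≃ y' → IsMeet x y z → IsMeet x' y' z' →
              Shaped w → z ⊆ w → z ⊆ₐ z'
    meet-⊆ₐ x x' y y' z z' w x≃x' y≃y' (z⊆x , z⊆y , _) (_ , _ , glb') sh z⊆w i j h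
      with apex-interior w z sh z⊆w
    ... | z⁻ , z⁻⊆z , z⊆ₐz⁻ , z⁻aa with z⊆ₐz⁻ i j h
    ...   | inj₂ apex = inj₂ apex
    ...   | inj₁ z⁻ij =
      inj₁ (glb' z⁻ (≃-⊇-apexless x x' z⁻ x≃x' (⊆-trans {z⁻} {z} {x} z⁻⊆z z⊆x) z⁻aa)
                    (≃-⊇-apexless y y' z⁻ y≃y' (⊆-trans {z⁻} {z} {y} z⁻⊆z z⊆y) z⁻aa)
                    i j z⁻ij)

    θ : Bip n → Bip n → Set
    θ x y = x ≃ y × ((rel x a a ≡ rel y a a) ⊎ (Shaped x × Shaped y))

    -- θ holds between elements agreeing away from the apex when each is shaped as
    -- soon as its apex entry takes a given value b: if the apex entries differ, one
    -- of them is b.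
    θ-intro : (z z' : Bip n) (b : Bool) → z ≃ z' →
              (rel z a a ≡ b → Shaped z) → (rel z' a a ≡ b → Shaped z') → θ z z'
    θ-intro z z' b z≃z' sh sh' with rel z a a ≟ᵇ b | rel z' a a ≟ᵇ b
    ... | yes za | _      = z≃z' , inj₂ (sh za , shaped-≃ z z' z≃z' (sh za))
    ... | no _   | yes z'a = z≃z' , inj₂ (shaped-≃ z' z (≃-sym z z' z≃z') (sh' z'a) , sh' z'a)
    ... | no za  | no z'a  = z≃z' , inj₁ (≡-trans (¬-not za) (≡-sym (¬-not z'a)))

    ≈⇒θ : (x y : Bip n) → x ≈ y → θ x y
    ≈⇒θ x y x≈y = ≈⇒≃ x y x≈y , inj₁ (≈⇒≡ {x} {y} x≈y a a)

    θ-sym : (x y : Bip n) → θ x y → θ y x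
    θ-sym x y (x≃y , inj₁ e)           = ≃-sym x y x≃y , inj₁ (≡-sym e)
    θ-sym x y (x≃y , inj₂ (shx , shy)) = ≃-sym x y x≃y , inj₂ (shy , shx)

    θ-trans : (x y z : Bip n) → θ x y → θ y z → θ x z
    θ-trans x y z (x≃y , xy) (y≃z , yz) = x≃z , apex xy yz
      where
        x≃z : x ≃ z
        x≃z i j off = ≡-trans (x≃y i j off) (y≃z i j off)
        apex : (rel x a a ≡ rel y a a) ⊎ (Shaped x × Shaped y) →
               (rel y a a ≡ rel z a a) ⊎ (Shaped y × Shaped z) →
               (rel x a a ≡ rel z a a) ⊎ (Shaped x × Shaped z)
        apex (inj₁ e₁)        (inj₁ e₂)        = inj₁ (≡-trans e₁ e₂)
        apex (inj₂ (shx , _)) _                = inj₂ (shx , shaped-≃ x z x≃z shx)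
        apex (inj₁ _)         (inj₂ (_ , shz)) = inj₂ (shaped-≃ z x (≃-sym x z x≃z) shz , shz)

    θ-join-shaped : ∀ x x' y y' z z' w w' → x ≃ x' → y ≃ y' → IsJoin x y z → IsJoin x' y' z' →
                    Shaped w → w ⊆ z → Shaped w' → w' ⊆ z' → θ z z'
    θ-join-shaped x x' y y' z z' w w' x≃x' y≃y' J J' sh w⊆z sh' w'⊆z' =
      θ-intro z z' false
        (⊆ₐ-antisym z z'
          (join-⊆ₐ x' x y' y z' z w' (≃-sym x x' x≃x') (≃-sym y y' y≃y') J' J sh' w'⊆z')
          (join-⊆ₐ x x' y y' z z' w x≃x' y≃y' J J' sh w⊆z))
        (shaped-up w z sh w⊆z) (shaped-up w' z' sh' w'⊆z')

    -- If one argument pair is shaped, the joins agree away from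
    -- the apex and are shaped where they lack the loop; otherwise all arguments agree
    -- exactly and so do the joins.
    θ-join : ∀ x x' y y' z z' → θ x x' → θ y y' → IsJoin x y z → IsJoin x' y' z' → θ z z'
    θ-join x x' y y' z z' (x≃x' , inj₂ (shx , shx')) (y≃y' , _) J J' =
      θ-join-shaped x x' y y' z z' x x' x≃x' y≃y' J J' shx (proj₁ J) shx' (proj₁ J')
    θ-join x x' y y' z z' (x≃x' , inj₁ _) (y≃y' , inj₂ (shy , shy')) J J' =
      θ-join-shaped x x' y y' z z' y y' x≃x' y≃y' J J'
                    shy (proj₁ (proj₂ J)) shy' (proj₁ (proj₂ J'))
    θ-join x x' y y' z z' (x≃x' , inj₁ xa) (y≃y' , inj₁ ya) J J' =
      ≈⇒θ z z' (join-unique {x} {x'} {y} {y'} {z} {z'}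
                            (≃-apex-≈ x x' x≃x' xa) (≃-apex-≈ y y' y≃y' ya) J J')

    θ-meet-shaped : ∀ x x' y y' z z' w w' → x ≃ x' → y ≃ y' → IsMeet x y z → IsMeet x' y' z' →
                    Shaped w → z ⊆ w → Shaped w' → z' ⊆ w' → θ z z'
    θ-meet-shaped x x' y y' z z' w w' x≃x' y≃y' M M' sh z⊆w sh' z'⊆w' =
      θ-intro z z' true
        (⊆ₐ-antisym z z'
          (meet-⊆ₐ x x' y y' z z' w x≃x' y≃y' M M' sh z⊆w)
          (meet-⊆ₐ x' x y' y z' z w' (≃-sym x x' x≃x') (≃-sym y y' y≃y') M' M sh' z'⊆w'))
        (shaped-down w z sh z⊆w) (shaped-down w' z' sh' z'⊆w')

    θ-meet : ∀ x x' y y' z z' → θ x x' → θ y y' → IsMeet x y z → IsMeet x' y' z' → θ z z'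
    θ-meet x x' y y' z z' (x≃x' , inj₂ (shx , shx')) (y≃y' , _) M M' =
      θ-meet-shaped x x' y y' z z' x x' x≃x' y≃y' M M' shx (proj₁ M) shx' (proj₁ M')
    θ-meet x x' y y' z z' (x≃x' , inj₁ _) (y≃y' , inj₂ (shy , shy')) M M' =
      θ-meet-shaped x x' y y' z z' y y' x≃x' y≃y' M M'
                    shy (proj₁ (proj₂ M)) shy' (proj₁ (proj₂ M'))
    θ-meet x x' y y' z z' (x≃x' , inj₁ xa) (y≃y' , inj₁ ya) M M' =
      ≈⇒θ z z' (meet-unique {x} {x'} {y} {y'} {z} {z'}
                            (≃-apex-≈ x x' x≃x' xa) (≃-apex-≈ y y' y≃y' ya) M M')

    θ-congruence : IsCongruence θ
    θ-congruence = record
      { refl≈ = ≈⇒θ ; sym = θ-sym ; trans = θ-trans ; join-compat = θ-join ; meet-compat = θ-meet }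

    without-apex-⊆ : (p : Bip n) (sh : Shaped p) → without-apex p sh ⊆ p
    without-apex-⊆ p sh i j h = ∧-conicalˡ (rel p i j) _ h

    without-apex-≃ : (p : Bip n) (sh : Shaped p) → without-apex p sh ≃ p
    without-apex-≃ p sh i j off rewrite isApex-false off = ∧-identityʳ (rel p i j)

    without-apex-θ : (p : Bip n) (sh : Shaped p) → θ (without-apex p sh) p
    without-apex-θ p sh = p⁻≃p , inj₂ (shaped-≃ p p⁻ (≃-sym p⁻ p p⁻≃p) sh , sh)
      where
        p⁻ : Bip n
        p⁻ = without-apex p sh
        p⁻≃p : p⁻ ≃ p
        p⁻≃p = without-apex-≃ p sh

    -- For shaped p with the apex loop, p without the loop is a lower cover of p:
    -- anything in between is decided by its apex entry.
    without-apex-⋖ : (p : Bip n) (sh : Shaped p) → rel p a a ≡ true → without-apex p sh ⋖ p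
    without-apex-⋖ p sh paa =
      without-apex-⊆ p sh , (λ p⊆p⁻ → clash (p⊆p⁻ a a paa) (apex-out p sh)) , between
      where
        p⁻ : Bip n
        p⁻ = without-apex p sh
        between : ∀ z → p⁻ ⊆ z → z ⊆ p → (z ≈ p⁻) ⊎ (z ≈ p)
        between z p⁻⊆z z⊆p with bool-split (rel z a a)
        ... | inj₁ zaa = inj₂ (z⊆p , ≃-⊆-apexed p⁻ p z (without-apex-≃ p sh) p⁻⊆z zaa)
        ... | inj₂ zaa =
          inj₁ (≃-⊇-apexless p p⁻ z (≃-sym p⁻ p (without-apex-≃ p sh)) z⊆p zaa , p⁻⊆z)

    K : Bip n
    K = clepsydra a U

    clepsydra-apex : rel K a a ≡ true
    clepsydra-apex rewrite dec-true (a ≟ a) refl = refl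

    clepsydra-shaped : Shaped K
    clepsydra-shaped j j≢a rewrite dec-true (a ≟ a) refl | dec-false (j ≟ a) j≢a =
      refl , ∧-identityʳ (not (U j))

    clepsydra-least : (c : Bip n) → Shaped c → rel c a a ≡ true → K ⊆ c
    clepsydra-least c sh caa i j h =
      clepsydra-below c a caa i j
        (≡-trans (clepsydra-cong a (rel c a) U (λ j j≢a → proj₁ (sh j j≢a)) i j) h)

    -- Every lower cover c of K is θ-related to K: c cannot have the apex loop (it
    -- would then contain K), so c is K without its apex loop.
    clepsydra-covers : ∀ c → c ⋖ K → θ c K
    clepsydra-covers c (c⊆K , K⊈c , between) =
      θ-trans c K⁻ K (≈⇒θ c K⁻ c≈K⁻) (without-apex-θ K clepsydra-shaped)
      where
        K⁻ : Bip n
        K⁻ = without-apex K clepsydra-shaped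
        caa : rel c a a ≡ false
        caa = ≢true⇒false λ caa →
          K⊈c (clepsydra-least c (shaped-down K c clepsydra-shaped c⊆K caa) caa)
        c⊆K⁻ : c ⊆ K⁻
        c⊆K⁻ = ≃-⊇-apexless K K⁻ c (≃-sym K⁻ K (without-apex-≃ K clepsydra-shaped)) c⊆K caa
        c≈K⁻ : c ≈ K⁻
        c≈K⁻ with between K⁻ c⊆K⁻ (without-apex-⊆ K clepsydra-shaped)
        ... | inj₁ K⁻≈c = ≈-sym {K⁻} {c} K⁻≈c
        ... | inj₂ K⁻≈K =
          ⊥-elim (clash (proj₂ K⁻≈K a a clepsydra-apex) (apex-out K clepsydra-shaped))

    -- Conversely, a join-irreducible p with a lower cover c such that θ c p is K:
    -- θ can only identify c and p through the apex loop of a shaped p.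
    θ-cover-clepsydra : (p c : Bip n) → JoinIrreducible p → c ⋖ p → θ c p → p ≈ K
    θ-cover-clepsydra p c ji (c⊆p , p⊈c , _) (c≃p , link) with bool-split (rel p a a) | link
    ... | inj₂ paa | _ =
      ⊥-elim (p⊈c (proj₂ (≃-apex-≈ c p c≃p (≡-trans (⊆-false c p c⊆p a a paa) (≡-sym paa)))))
    ... | inj₁ _   | inj₁ same = ⊥-elim (p⊈c (proj₂ (≃-apex-≈ c p c≃p same)))
    ... | inj₁ paa | inj₂ (_ , shp) =
      ≈-trans {p} {clepsydra a (rel p a)} {K} (loop-clepsydra p ji a paa)
              (≡⇒≈ {clepsydra a (rel p a)} {K}
                   (clepsydra-cong a (rel p a) U (λ j j≢a → proj₁ (shp j j≢a))))

  -- Every join-irreducible has a lower cover: ⊥ if it is bipartite, and itself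
  -- without its loop if it has a loop (it is then a shaped clepsydra).
  lower-cover : (p : Bip n) → JoinIrreducible p → Σ[ c ∈ Bip n ] c ⋖ p
  lower-cover p ji with bipartite-or-loop p ji
  ... | inj₁ p-bipartite = ⊥B , bipartite-⊥⋖ p p-bipartite
  ... | inj₂ (b , pbb)   = without-apex p shaped , without-apex-⋖ p shaped pbb
    where
      open ApexCongruence b (rel p b)
      shaped : Shaped p
      shaped = shaped-≃ K p (≈⇒≃ K p (≈-sym {p} {K} (loop-clepsydra p ji b pbb))) clepsydra-shaped

  -- If con(p) ⊆ con(q) and q has a loop at a, then p is a clepsydra equal to q:
  -- q is the clepsydra K with apex a, the apex congruence θ contains con(q), hence
  -- relates p to a lower cover, and this forces p ≈ K.
  ⊑-loop-clepsydra : (p q : Bip n) → JoinIrreducible p → JoinIrreducible q →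
                     ∀ a → rel q a a ≡ true → p ⊑ q → Clepsydra p × (p ≈ q)
  ⊑-loop-clepsydra p q jip jiq a qaa p⊑q with lower-cover p jip
  ... | c , c⋖p =
    (a , rel q a , ≈⇒≡ {p} {K} p≈K) , ≈-trans {p} {K} {q} p≈K (≈-sym {q} {K} q≈K)
    where
      open ApexCongruence a (rel q a)
      q≈K : q ≈ K
      q≈K = loop-clepsydra q jiq a qaa
      q-covers : ∀ c → c ⋖ q → θ c q
      q-covers c c⋖q = θ-trans c K q (clepsydra-covers c (⋖-resp-≈ {c} {q} {K} c⋖q q≈K))
                                     (≈⇒θ K q (≈-sym {q} {K} q≈K))
      cθp : θ c p
      cθp = p⊑q c p (λ _ _ p-covers → p-covers c c⋖p) θ θ-congruence q-covers
      p≈K : p ≈ K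
      p≈K = θ-cover-clepsydra p c jip c⋖p cθp

corollary8p5 : (n : ℕ) → 3 ≤ n → (p q : Bip n) →
    JoinIrreducible p → JoinIrreducible q →
    ((p ⊑ q) ⇔ (Bipartite q ⊎ (Clepsydra p × (p ≈ q))))
corollary8p5 n 3≤n p q jip jiq = mk⇔ forward backward
  where
    forward : p ⊑ q → Bipartite q ⊎ (Clepsydra p × (p ≈ q))
    forward p⊑q with bipartite-or-loop q jiq
    ... | inj₁ q-bipartite = inj₁ q-bipartite
    ... | inj₂ (a , qaa)   = inj₂ (⊑-loop-clepsydra p q jip jiq a qaa p⊑q)
    backward : Bipartite q ⊎ (Clepsydra p × (p ≈ q)) → p ⊑ q
    backward (inj₁ q-bipartite) x y _ = con-bipartite-total (three-points 3≤n) q q-bipartite x y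
    backward (inj₂ (_ , p≈q))       = ≈⇒⊑ p q p≈q
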